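{- For every integer $n\ge 3$ there exists a Heffter array $H(3,n)$. If moreover $n\equiv 0,1\pmod 4$, then the array can be taken to be an integer Heffter array.
   Context: A (tight) Heffter array $H(m,n)$ is an $m\times n$ array with every cell filled by an element of $\mathbb{Z}_{2mn+1}$ such that every row and every column sums to $0$ modulo $2mn+1$, and no element of any pair $\{x,-x\}$ appears twice (using representatives $-mn,\dots,mn$, entries are nonzero and each of $1,\dots,mn$ appears exactly once up to sign). An integer Heffter array $H(m,n)$ is an $m\times n$ array with entries from $\{ -mn,\dots,mn\}$ such that every row and column sums to $0$ over the integers and no element from any $\{x,-x\}$ appears twice, so the multiset of absolute values of entries is $\{1,\dots,mn\}$. -}

module Defs where

open import Data.Nat as ℕ using (ℕ)
open import Data.Integer as ℤ using (ℤ; +_; -_; ∣_∣)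
open import Data.Integer.Divisibility using () renaming (_∣_ to _∣ℤ_)
open import Data.Fin using (Fin; zero; suc)
open import Data.Product using (_×_; _,_)
open import Relation.Binary.PropositionalEquality using (_≡_; _≢_)
open import Relation.Nullary using (¬_)

Array : ℕ → ℕ → Set
Array m n = Fin m → Fin n → ℤ

Σℤ : (k : ℕ) → (Fin k → ℤ) → ℤ
Σℤ ℕ.zero    f = + 0
Σℤ (ℕ.suc k) f = f zero ℤ.+ Σℤ k (λ i → f (suc i))

rowSum : ∀ {m n} → Array m n → Fin m → ℤ
rowSum {m} {n} A i = Σℤ n (λ j → A i j)

colSum : ∀ {m n} → Array m n → Fin n → ℤ
colSum {m} {n} A j = Σℤ m (λ i → A i j)

-- Entry conditions common to both notions: every entry lies in {-mn,…,mn},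
-- is nonzero, and no element of any pair {x,-x} appears twice
-- (i.e. distinct cells have distinct absolute values).  Since there are
-- mn cells, the absolute values are then exactly {1,…,mn}.
HeffterEntries : (m n : ℕ) → Array m n → Set
HeffterEntries m n A =
  (∀ i j → (- (+ (m ℕ.* n)) ℤ.≤ A i j) × (A i j ℤ.≤ + (m ℕ.* n)) × (A i j ≢ + 0))
  × (∀ i j i' j' → ∣ A i j ∣ ≡ ∣ A i' j' ∣ → (i ≡ i') × (j ≡ j'))

-- (Tight) Heffter array H(m,n): entries of ℤ_{2mn+1} given by representatives
-- in {-mn,…,mn}; every row and column sums to 0 modulo 2mn+1.
IsHeffter : (m n : ℕ) → Array m n → Set
IsHeffter m n A =
  HeffterEntries m n A
  × (∀ i → (+ (2 ℕ.* (m ℕ.* n) ℕ.+ 1)) ∣ℤ rowSum A i)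
  × (∀ j → (+ (2 ℕ.* (m ℕ.* n) ℕ.+ 1)) ∣ℤ colSum A j)

IsIntegerHeffter : (m n : ℕ) → Array m n → Set
IsIntegerHeffter m n A =
  HeffterEntries m n A
  × (∀ i → rowSum A i ≡ + 0)
  × (∀ j → colSum A j ≡ + 0)

-- Write n = w + 4t with w ∈ {3, 4, 5, 6} determined by n mod 4. The array has w fixed
-- columns followed by t copies of a four-column block; in the copy with index a some entries
-- move with a and others with k = t - 1 - a. The absolute values 1, …, 3n are laid out as a
-- sequence of segments of length independent of t, t or 2t, so that each entry of a small
-- 3 × (w + 4) template names a slot (segment, offset, q ∈ {0, a, k}) and the array entry is
-- ±(1 + position of the slot). Every entry is then an affine function of t, a and k, and all
-- the Heffter conditions become finitely many identities between affine forms: inside a block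
-- t = a + 1 + k makes the block rows sum to constants ρ and the block columns to 0, while the
-- fixed part of a row plus ρ t is a multiple of 6n + 1 = 6w + 1 + 24t, and this multiple is 0
-- for w = 4, 5. Absolute values are distinct because distinct template entries occupy
-- distinct slots and the slot determines the cell. The four templates are checked by evaluation.
module Submission where

open import Defs
open import Data.Nat using (ℕ; _≤_; _%_)
open import Data.Product using (Σ; _×_)
open import Data.Sum using (_⊎_)
open import Relation.Binary.PropositionalEquality using (_≡_)

open import Data.Bool using (Bool; true; false)
open import Data.Empty using (⊥; ⊥-elim)
open import Data.Fin using (Fin; zero; suc; toℕ; _↑ˡ_; _↑ʳ_; splitAt; combine; remQuot; opposite)
open import Data.Fin.Properties
  using ( toℕ-injective; toℕ<n; toℕ-↑ˡ; toℕ-↑ʳ; toℕ-combine; splitAt-↑ˡ; splitAt-↑ʳ; splitAt⁻¹-↑ˡ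
        ; splitAt⁻¹-↑ʳ; remQuot-combine; combine-remQuot; opposite-prop; opposite-involutive; all?)
  renaming (_≟_ to _≟ᶠ_)
open import Data.Integer as ℤ using (ℤ; +_; -_; -[1+_]; ∣_∣)
open import Data.Integer.Properties
  using (+-identityˡ; +-assoc; *-zeroʳ; +-injective; pos-+; pos-*; ∣-i∣≡∣i∣; neg-≤-pos; neg-mono-≤; abs-*)
  renaming (_≟_ to _≟ℤ_)
open import Data.Integer.Divisibility using (divides) renaming (_∣_ to _∣ℤ_)
open import Data.Integer.Tactic.RingSolver using (solve-∀)
open import Data.List using (List; []; _∷_)
open import Data.Nat using (zero; suc; _+_; _*_; _∸_; _<_; _/_; s≤s; _<?_)
open import Data.Nat.DivMod using (m≡m%n+[m/n]*n; m%n<n; m<n⇒m%n≡m; [m+kn]%n≡m%n)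
open import Data.Nat.Properties
  using ( +-comm; +-identityʳ; suc-injective; *-comm; *-suc; +-cancelˡ-≡; *-cancelˡ-≡; m≤m+n; <-≤-trans
        ; <⇒≢; +-monoˡ-<; +-monoʳ-<; *-monoʳ-≤; m+[n∸m]≡n)
  renaming (_≟_ to _≟ℕ_)
import Data.Nat.Tactic.RingSolver as ℕ-Ring
open import Data.Product using (_,_; proj₁; proj₂)
open import Data.Product.Properties using (≡-dec)
open import Data.Sum using (inj₁; inj₂; [_,_]′)
open import Data.Vec using (Vec; []; _∷_; lookup)
open import Function using (_∘_)
open import Relation.Binary.Definitions using (DecidableEquality)
open import Relation.Binary.PropositionalEquality
  using (_≢_; refl; sym; trans; cong; cong₂; subst; module ≡-Reasoning)
open import Relation.Nullary using (Dec; yes; no; ¬_)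
open import Relation.Nullary.Decidable using (map′; _×-dec_; _→-dec_; ¬?; from-yes)

Σℤ-cong : ∀ k {f g : Fin k → ℤ} → (∀ i → f i ≡ g i) → Σℤ k f ≡ Σℤ k g
Σℤ-cong zero    f≗g = refl
Σℤ-cong (suc k) f≗g = cong₂ ℤ._+_ (f≗g zero) (Σℤ-cong k (f≗g ∘ suc))

Σℤ-↑ : ∀ m n (f : Fin (m + n) → ℤ) →
  Σℤ (m + n) f ≡ Σℤ m (f ∘ (_↑ˡ n)) ℤ.+ Σℤ n (f ∘ (m ↑ʳ_))
Σℤ-↑ zero    n f = sym (+-identityˡ _)
Σℤ-↑ (suc m) n f = trans (cong (ℤ._+_ (f zero)) (Σℤ-↑ m n (f ∘ suc))) (sym (+-assoc (f zero) _ _))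

Σℤ-combine : ∀ m n (f : Fin (m * n) → ℤ) → Σℤ (m * n) f ≡ Σℤ m (λ a → Σℤ n (f ∘ combine a))
Σℤ-combine zero    n f = refl
Σℤ-combine (suc m) n f =
  trans (Σℤ-↑ n (m * n) f) (cong (ℤ._+_ (Σℤ n (f ∘ (_↑ˡ m * n)))) (Σℤ-combine m n (f ∘ (n ↑ʳ_))))

Σℤ-const : ∀ k c → Σℤ k (λ _ → c) ≡ c ℤ.* + k
Σℤ-const zero    c = sym (*-zeroʳ c)
Σℤ-const (suc k) c = trans (cong (ℤ._+_ c) (Σℤ-const k c)) (distribute c (+ k))
  where
  distribute : ∀ c x → c ℤ.+ c ℤ.* x ≡ c ℤ.* (+ 1 ℤ.+ x)
  distribute = solve-∀

-- Layouts of the absolute values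

data Segment : Set where
  fixed  : ℕ → Segment
  single : Segment
  double : Segment

Layout : Set
Layout = List Segment

size : ℕ → Segment → ℕ
size t (fixed g) = g
size t single    = t
size t double    = 2 * t

offset : Segment → ℕ → ℕ → ℕ
offset (fixed g) r q = r
offset single    r q = q
offset double    r q = r + 2 * q

InSegment : ℕ → Segment → ℕ → ℕ → Set
InSegment t (fixed g) r q = r < g × q ≡ 0
InSegment t single    r q = r ≡ 0 × q < t
InSegment t double    r q = r < 2 × q < t

AtSegment : (Segment → Set) → Layout → ℕ → Set
AtSegment P []      s       = ⊥
AtSegment P (x ∷ L) zero    = P x
AtSegment P (x ∷ L) (suc s) = AtSegment P L s

at-map : ∀ {P Q : Segment → Set} → (∀ {x} → P x → Q x) → ∀ L s → AtSegment P L s → AtSegment Q L s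
at-map f (x ∷ L) zero    p = f p
at-map f (x ∷ L) (suc s) p = at-map f L s p

at? : ∀ {P : Segment → Set} → (∀ x → Dec (P x)) → ∀ L s → Dec (AtSegment P L s)
at? P? []      s       = no λ ()
at? P? (x ∷ L) zero    = P? x
at? P? (x ∷ L) (suc s) = at? P? L s

ValidSlot : ℕ → Layout → ℕ → ℕ → ℕ → Set
ValidSlot t L s r q = AtSegment (λ x → InSegment t x r q) L s

position : ℕ → Layout → ℕ → ℕ → ℕ → ℕ
position t []      s       r q = 0
position t (x ∷ L) zero    r q = offset x r q
position t (x ∷ L) (suc s) r q = size t x + position t L s r q

span : ℕ → Layout → ℕ
span t []      = 0
span t (x ∷ L) = size t x + span t L

offset<size : ∀ t x {r q} → InSegment t x r q → offset x r q < size t x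
offset<size t (fixed g) (r<g , _) = r<g
offset<size t single    (_ , q<t) = q<t
offset<size t double {r} {q} (r<2 , q<t) =
  <-≤-trans (+-monoˡ-< (2 * q) r<2) (subst (_≤ 2 * t) (*-suc 2 q) (*-monoʳ-≤ 2 q<t))

double-offset-injective : ∀ {r q r′ q′} → r < 2 → r′ < 2 →
  r + 2 * q ≡ r′ + 2 * q′ → r ≡ r′ × q ≡ q′
double-offset-injective {r} {q} {r′} {q′} r<2 r′<2 eq =
  r≡r′ , *-cancelˡ-≡ q q′ 2 (+-cancelˡ-≡ r _ _ (trans eq (cong (_+ 2 * q′) (sym r≡r′))))
  where
  open ≡-Reasoning
  r≡r′ : r ≡ r′
  r≡r′ = begin
    r                 ≡⟨ m<n⇒m%n≡m r<2 ⟨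
    r % 2             ≡⟨ [m+kn]%n≡m%n r q 2 ⟨
    (r + q * 2) % 2   ≡⟨ cong (λ w → (r + w) % 2) (*-comm q 2) ⟩
    (r + 2 * q) % 2   ≡⟨ cong (_% 2) eq ⟩
    (r′ + 2 * q′) % 2 ≡⟨ cong (λ w → (r′ + w) % 2) (*-comm 2 q′) ⟩
    (r′ + q′ * 2) % 2 ≡⟨ [m+kn]%n≡m%n r′ q′ 2 ⟩
    r′ % 2            ≡⟨ m<n⇒m%n≡m r′<2 ⟩
    r′                ∎

offset-injective : ∀ t x {r q r′ q′} → InSegment t x r q → InSegment t x r′ q′ →
  offset x r q ≡ offset x r′ q′ → r ≡ r′ × q ≡ q′
offset-injective t (fixed g) (_ , refl) (_ , refl) r≡r′ = r≡r′ , refl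
offset-injective t single    (refl , _) (refl , _) q≡q′ = refl , q≡q′
offset-injective t double    (r<2 , _)  (r′<2 , _) eq   = double-offset-injective r<2 r′<2 eq

position-injective : ∀ t L {s r q s′ r′ q′} → ValidSlot t L s r q → ValidSlot t L s′ r′ q′ →
  position t L s r q ≡ position t L s′ r′ q′ → s ≡ s′ × r ≡ r′ × q ≡ q′
position-injective t (x ∷ L) {zero}  {s′ = zero}  v v′ eq = refl , offset-injective t x v v′ eq
position-injective t (x ∷ L) {zero}  {s′ = suc _} v v′ eq =
  ⊥-elim (<⇒≢ (<-≤-trans (offset<size t x v) (m≤m+n _ _)) eq)
position-injective t (x ∷ L) {suc _} {s′ = zero}  v v′ eq =
  ⊥-elim (<⇒≢ (<-≤-trans (offset<size t x v′) (m≤m+n _ _)) (sym eq))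
position-injective t (x ∷ L) {suc _} {s′ = suc _} v v′ eq
  with position-injective t L v v′ (+-cancelˡ-≡ (size t x) _ _ eq)
... | refl , r≡r′ , q≡q′ = refl , r≡r′ , q≡q′

position<span : ∀ t L {s r q} → ValidSlot t L s r q → position t L s r q < span t L
position<span t (x ∷ L) {zero}  v = <-≤-trans (offset<size t x v) (m≤m+n _ _)
position<span t (x ∷ L) {suc s} v = +-monoʳ-< (size t x) (position<span t L v)

-- Affine forms in t, a and k

record Affine : Set where
  constructor affine
  field c₀ cₜ cₐ cₖ : ℤ

⟦_⟧ : Affine → ℤ → ℤ → ℤ → ℤ
⟦ affine c₀ cₜ cₐ cₖ ⟧ t a k = c₀ ℤ.+ cₜ ℤ.* t ℤ.+ cₐ ℤ.* a ℤ.+ cₖ ℤ.* k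

constant : ℤ → Affine
constant c = affine c (+ 0) (+ 0) (+ 0)

varT varA varK : Affine
varT = affine (+ 0) (+ 1) (+ 0) (+ 0)
varA = affine (+ 0) (+ 0) (+ 1) (+ 0)
varK = affine (+ 0) (+ 0) (+ 0) (+ 1)

infixl 6 _⊕_
infixl 7 _·_

_⊕_ : Affine → Affine → Affine
affine c x y z ⊕ affine c′ x′ y′ z′ = affine (c ℤ.+ c′) (x ℤ.+ x′) (y ℤ.+ y′) (z ℤ.+ z′)

_·_ : ℤ → Affine → Affine
l · affine c x y z = affine (l ℤ.* c) (l ℤ.* x) (l ℤ.* y) (l ℤ.* z)

⊖_ : Affine → Affine
⊖ affine c x y z = affine (- c) (- x) (- y) (- z)

eliminateT : Affine → Affine
eliminateT (affine c x y z) = affine (c ℤ.+ x) (+ 0) (y ℤ.+ x) (z ℤ.+ x)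

ΣA : (k : ℕ) → (Fin k → Affine) → Affine
ΣA zero    f = constant (+ 0)
ΣA (suc k) f = f zero ⊕ ΣA k (f ∘ suc)

_≟ᴬ_ : DecidableEquality Affine
affine c x y z ≟ᴬ affine c′ x′ y′ z′ =
  map′ (λ { (refl , refl , refl , refl) → refl }) (λ { refl → refl , refl , refl , refl })
       (c ≟ℤ c′ ×-dec x ≟ℤ x′ ×-dec y ≟ℤ y′ ×-dec z ≟ℤ z′)

-- The solver does not unfold ⟦_⟧, so each law is stated on the expanded polynomial.
⟦constant⟧ : ∀ c t a k → ⟦ constant c ⟧ t a k ≡ c
⟦constant⟧ = polynomial
  where
  polynomial : ∀ c t a k → c ℤ.+ + 0 ℤ.* t ℤ.+ + 0 ℤ.* a ℤ.+ + 0 ℤ.* k ≡ c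
  polynomial = solve-∀

⟦varT⟧ : ∀ t a k → ⟦ varT ⟧ t a k ≡ t
⟦varT⟧ = polynomial
  where
  polynomial : ∀ t a k → + 0 ℤ.+ + 1 ℤ.* t ℤ.+ + 0 ℤ.* a ℤ.+ + 0 ℤ.* k ≡ t
  polynomial = solve-∀

⟦varA⟧ : ∀ t a k → ⟦ varA ⟧ t a k ≡ a
⟦varA⟧ = polynomial
  where
  polynomial : ∀ t a k → + 0 ℤ.+ + 0 ℤ.* t ℤ.+ + 1 ℤ.* a ℤ.+ + 0 ℤ.* k ≡ a
  polynomial = solve-∀

⟦varK⟧ : ∀ t a k → ⟦ varK ⟧ t a k ≡ k
⟦varK⟧ = polynomial
  where
  polynomial : ∀ t a k → + 0 ℤ.+ + 0 ℤ.* t ℤ.+ + 0 ℤ.* a ℤ.+ + 1 ℤ.* k ≡ k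
  polynomial = solve-∀

⟦⊕⟧ : ∀ f g t a k → ⟦ f ⊕ g ⟧ t a k ≡ ⟦ f ⟧ t a k ℤ.+ ⟦ g ⟧ t a k
⟦⊕⟧ (affine c x y z) (affine c′ x′ y′ z′) = polynomial c x y z c′ x′ y′ z′
  where
  polynomial : ∀ c x y z c′ x′ y′ z′ t a k →
    (c ℤ.+ c′) ℤ.+ (x ℤ.+ x′) ℤ.* t ℤ.+ (y ℤ.+ y′) ℤ.* a ℤ.+ (z ℤ.+ z′) ℤ.* k
      ≡ (c ℤ.+ x ℤ.* t ℤ.+ y ℤ.* a ℤ.+ z ℤ.* k)
        ℤ.+ (c′ ℤ.+ x′ ℤ.* t ℤ.+ y′ ℤ.* a ℤ.+ z′ ℤ.* k)
  polynomial = solve-∀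

⟦·⟧ : ∀ l f t a k → ⟦ l · f ⟧ t a k ≡ l ℤ.* ⟦ f ⟧ t a k
⟦·⟧ l (affine c x y z) = polynomial l c x y z
  where
  polynomial : ∀ l c x y z t a k →
    l ℤ.* c ℤ.+ l ℤ.* x ℤ.* t ℤ.+ l ℤ.* y ℤ.* a ℤ.+ l ℤ.* z ℤ.* k
      ≡ l ℤ.* (c ℤ.+ x ℤ.* t ℤ.+ y ℤ.* a ℤ.+ z ℤ.* k)
  polynomial = solve-∀

⟦⊖⟧ : ∀ f t a k → ⟦ ⊖ f ⟧ t a k ≡ - ⟦ f ⟧ t a k
⟦⊖⟧ (affine c x y z) = polynomial c x y z
  where
  polynomial : ∀ c x y z t a k →
    - c ℤ.+ - x ℤ.* t ℤ.+ - y ℤ.* a ℤ.+ - z ℤ.* k ≡ - (c ℤ.+ x ℤ.* t ℤ.+ y ℤ.* a ℤ.+ z ℤ.* k)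
  polynomial = solve-∀

⟦eliminateT⟧ : ∀ f t a k → ⟦ eliminateT f ⟧ t a k ≡ ⟦ f ⟧ (a ℤ.+ + 1 ℤ.+ k) a k
⟦eliminateT⟧ (affine c x y z) = polynomial c x y z
  where
  polynomial : ∀ c x y z t a k →
    (c ℤ.+ x) ℤ.+ + 0 ℤ.* t ℤ.+ (y ℤ.+ x) ℤ.* a ℤ.+ (z ℤ.+ x) ℤ.* k
      ≡ c ℤ.+ x ℤ.* (a ℤ.+ + 1 ℤ.+ k) ℤ.+ y ℤ.* a ℤ.+ z ℤ.* k
  polynomial = solve-∀

⟦ΣA⟧ : ∀ n f t a k → ⟦ ΣA n f ⟧ t a k ≡ Σℤ n (λ i → ⟦ f i ⟧ t a k)
⟦ΣA⟧ zero    f t a k = ⟦constant⟧ (+ 0) t a k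
⟦ΣA⟧ (suc n) f t a k =
  trans (⟦⊕⟧ (f zero) (ΣA n (f ∘ suc)) t a k)
        (cong (ℤ._+_ (⟦ f zero ⟧ t a k)) (⟦ΣA⟧ n (f ∘ suc) t a k))

⟦affineT⟧ : ∀ c d t a k → ⟦ constant (+ c) ⊕ + d · varT ⟧ (+ t) a k ≡ + (c + d * t)
⟦affineT⟧ c d t a k = begin
  ⟦ constant (+ c) ⊕ + d · varT ⟧ (+ t) a k
    ≡⟨ ⟦⊕⟧ (constant (+ c)) (+ d · varT) (+ t) a k ⟩
  ⟦ constant (+ c) ⟧ (+ t) a k ℤ.+ ⟦ + d · varT ⟧ (+ t) a k
    ≡⟨ cong₂ ℤ._+_ (⟦constant⟧ (+ c) (+ t) a k) (⟦·⟧ (+ d) varT (+ t) a k) ⟩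
  + c ℤ.+ + d ℤ.* ⟦ varT ⟧ (+ t) a k
    ≡⟨ cong (λ w → + c ℤ.+ + d ℤ.* w) (⟦varT⟧ (+ t) a k) ⟩
  + c ℤ.+ + d ℤ.* + t
    ≡⟨ cong (ℤ._+_ (+ c)) (pos-* d t) ⟨
  + c ℤ.+ + (d * t)
    ≡⟨ pos-+ c (d * t) ⟨
  + (c + d * t)
    ∎
  where open ≡-Reasoning

sizeA : Segment → Affine
sizeA (fixed g) = constant (+ g)
sizeA single    = varT
sizeA double    = + 2 · varT

offsetA : Segment → ℕ → Affine → Affine
offsetA (fixed g) r q = constant (+ r)
offsetA single    r q = q
offsetA double    r q = constant (+ r) ⊕ + 2 · q

positionA : Layout → ℕ → ℕ → Affine → Affine
positionA []      s       r q = constant (+ 0)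
positionA (x ∷ L) zero    r q = offsetA x r q
positionA (x ∷ L) (suc s) r q = sizeA x ⊕ positionA L s r q

spanA : Layout → Affine
spanA []      = constant (+ 0)
spanA (x ∷ L) = sizeA x ⊕ spanA L

module _ (t : ℕ) (a k : ℤ) where
  open ≡-Reasoning

  ⟦sizeA⟧ : ∀ x → ⟦ sizeA x ⟧ (+ t) a k ≡ + size t x
  ⟦sizeA⟧ (fixed g) = ⟦constant⟧ (+ g) (+ t) a k
  ⟦sizeA⟧ single    = ⟦varT⟧ (+ t) a k
  ⟦sizeA⟧ double    = begin
    ⟦ + 2 · varT ⟧ (+ t) a k     ≡⟨ ⟦·⟧ (+ 2) varT (+ t) a k ⟩
    + 2 ℤ.* ⟦ varT ⟧ (+ t) a k   ≡⟨ cong (ℤ._*_ (+ 2)) (⟦varT⟧ (+ t) a k) ⟩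
    + 2 ℤ.* + t                  ≡⟨ pos-* 2 t ⟨
    + (2 * t)                    ∎

  ⟦offsetA⟧ : ∀ x r {q q′} → ⟦ q ⟧ (+ t) a k ≡ + q′ →
    ⟦ offsetA x r q ⟧ (+ t) a k ≡ + offset x r q′
  ⟦offsetA⟧ (fixed g) r q≡q′ = ⟦constant⟧ (+ r) (+ t) a k
  ⟦offsetA⟧ single    r q≡q′ = q≡q′
  ⟦offsetA⟧ double    r {q} {q′} q≡q′ = begin
    ⟦ constant (+ r) ⊕ + 2 · q ⟧ (+ t) a k
      ≡⟨ ⟦⊕⟧ (constant (+ r)) (+ 2 · q) (+ t) a k ⟩
    ⟦ constant (+ r) ⟧ (+ t) a k ℤ.+ ⟦ + 2 · q ⟧ (+ t) a k
      ≡⟨ cong₂ ℤ._+_ (⟦constant⟧ (+ r) (+ t) a k) (⟦·⟧ (+ 2) q (+ t) a k) ⟩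
    + r ℤ.+ + 2 ℤ.* ⟦ q ⟧ (+ t) a k
      ≡⟨ cong (λ w → + r ℤ.+ + 2 ℤ.* w) q≡q′ ⟩
    + r ℤ.+ + 2 ℤ.* + q′
      ≡⟨ cong (ℤ._+_ (+ r)) (pos-* 2 q′) ⟨
    + r ℤ.+ + (2 * q′)
      ≡⟨ pos-+ r (2 * q′) ⟨
    + (r + 2 * q′)
      ∎

  ⟦positionA⟧ : ∀ L s r {q q′} → ⟦ q ⟧ (+ t) a k ≡ + q′ →
    ⟦ positionA L s r q ⟧ (+ t) a k ≡ + position t L s r q′
  ⟦positionA⟧ []      s       r q≡q′ = ⟦constant⟧ (+ 0) (+ t) a k
  ⟦positionA⟧ (x ∷ L) zero    r q≡q′ = ⟦offsetA⟧ x r q≡q′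
  ⟦positionA⟧ (x ∷ L) (suc s) r {q} {q′} q≡q′ = begin
    ⟦ sizeA x ⊕ positionA L s r q ⟧ (+ t) a k
      ≡⟨ ⟦⊕⟧ (sizeA x) (positionA L s r q) (+ t) a k ⟩
    ⟦ sizeA x ⟧ (+ t) a k ℤ.+ ⟦ positionA L s r q ⟧ (+ t) a k
      ≡⟨ cong₂ ℤ._+_ (⟦sizeA⟧ x) (⟦positionA⟧ L s r q≡q′) ⟩
    + size t x ℤ.+ + position t L s r q′
      ≡⟨ pos-+ (size t x) _ ⟨
    + (size t x + position t L s r q′)
      ∎

  ⟦spanA⟧ : ∀ L → ⟦ spanA L ⟧ (+ t) a k ≡ + span t L
  ⟦spanA⟧ []      = ⟦constant⟧ (+ 0) (+ t) a k
  ⟦spanA⟧ (x ∷ L) = begin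
    ⟦ sizeA x ⊕ spanA L ⟧ (+ t) a k                  ≡⟨ ⟦⊕⟧ (sizeA x) (spanA L) (+ t) a k ⟩
    ⟦ sizeA x ⟧ (+ t) a k ℤ.+ ⟦ spanA L ⟧ (+ t) a k  ≡⟨ cong₂ ℤ._+_ (⟦sizeA⟧ x) (⟦spanA⟧ L) ⟩
    + size t x ℤ.+ + span t L                        ≡⟨ pos-+ (size t x) (span t L) ⟨
    + (size t x + span t L)                          ∎

-- In the copy of the block with index a out of t, an entry reads its slot with
-- q = 0, a or k = t - 1 - a according to its parameter none, up or down.
data Parameter : Set where
  none up down : Parameter

Entry : Set
Entry = Bool × ℕ × ℕ × Parameter

pos neg : ℕ → ℕ → Parameter → Entry
pos s r p = true  , s , r , p
neg s r p = false , s , r , p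

segmentOf offsetOf : Entry → ℕ
segmentOf (_ , s , _ , _) = s
offsetOf  (_ , _ , r , _) = r

parameterOf : Entry → Parameter
parameterOf (_ , _ , _ , p) = p

slotOf : Entry → ℕ × ℕ
slotOf (_ , s , r , _) = s , r

parameterValue : Parameter → ℕ → ℕ → ℕ
parameterValue none a k = 0
parameterValue up   a k = a
parameterValue down a k = k

parameterA : Parameter → Affine
parameterA none = constant (+ 0)
parameterA up   = varA
parameterA down = varK

signed : Bool → ℤ → ℤ
signed true  v = v
signed false v = - v

signedA : Bool → Affine → Affine
signedA true  f = f
signedA false f = ⊖ f

value : ℕ → Layout → Entry → ℕ → ℕ → ℤ
value t L (σ , s , r , p) a k = signed σ (+ suc (position t L s r (parameterValue p a k)))

entryA : Layout → Entry → Affine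
entryA L (σ , s , r , p) = signedA σ (constant (+ 1) ⊕ positionA L s r (parameterA p))

⟦parameterA⟧ : ∀ p t a k → ⟦ parameterA p ⟧ (+ t) (+ a) (+ k) ≡ + parameterValue p a k
⟦parameterA⟧ none t a k = ⟦constant⟧ (+ 0) (+ t) (+ a) (+ k)
⟦parameterA⟧ up   t a k = ⟦varA⟧ (+ t) (+ a) (+ k)
⟦parameterA⟧ down t a k = ⟦varK⟧ (+ t) (+ a) (+ k)

⟦signedA⟧ : ∀ σ f t a k → ⟦ signedA σ f ⟧ t a k ≡ signed σ (⟦ f ⟧ t a k)
⟦signedA⟧ true  f t a k = refl
⟦signedA⟧ false f t a k = ⟦⊖⟧ f t a k

⟦entryA⟧ : ∀ t L e a k → ⟦ entryA L e ⟧ (+ t) (+ a) (+ k) ≡ value t L e a k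
⟦entryA⟧ t L (σ , s , r , p) a k = begin
  ⟦ signedA σ (constant (+ 1) ⊕ positionA L s r (parameterA p)) ⟧ T A K
    ≡⟨ ⟦signedA⟧ σ _ T A K ⟩
  signed σ (⟦ constant (+ 1) ⊕ positionA L s r (parameterA p) ⟧ T A K)
    ≡⟨ cong (signed σ) (⟦⊕⟧ (constant (+ 1)) (positionA L s r (parameterA p)) T A K) ⟩
  signed σ (⟦ constant (+ 1) ⟧ T A K ℤ.+ ⟦ positionA L s r (parameterA p) ⟧ T A K)
    ≡⟨ cong (signed σ) (cong₂ ℤ._+_ (⟦constant⟧ (+ 1) T A K)
                                   (⟦positionA⟧ t A K L s r (⟦parameterA⟧ p t a k))) ⟩
  signed σ (+ 1 ℤ.+ + position t L s r (parameterValue p a k))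
    ∎
  where
  open ≡-Reasoning
  T = + t
  A = + a
  K = + k

∣signed∣ : ∀ σ v → ∣ signed σ v ∣ ≡ ∣ v ∣
∣signed∣ true  v = refl
∣signed∣ false v = ∣-i∣≡∣i∣ v

magnitude-bounds : ∀ {z v N} → ∣ z ∣ ≡ suc v → suc v ≤ N →
  (- (+ N) ℤ.≤ z) × (z ℤ.≤ + N) × (z ≢ + 0)
magnitude-bounds {+ _}       refl v<N = neg-≤-pos , ℤ.+≤+ v<N , λ ()
magnitude-bounds { -[1+ _ ]} refl v<N = neg-mono-≤ (ℤ.+≤+ v<N) , ℤ.-≤+ , λ ()

∣-multiple : ∀ {x} l m → x ≡ l ℤ.* m → m ∣ℤ x
∣-multiple l m refl = divides ∣ l ∣ (abs-* l m)

Fixed : ℕ → Segment → Set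
Fixed r (fixed g) = r < g
Fixed r single    = ⊥
Fixed r double    = ⊥

Run : ℕ → Segment → Set
Run r (fixed g) = ⊥
Run r single    = r ≡ 0
Run r double    = r < 2

Fits : Parameter → ℕ → Segment → Set
Fits none = Fixed
Fits up   = Run
Fits down = Run

fixed? : ∀ r x → Dec (Fixed r x)
fixed? r (fixed g) = r <? g
fixed? r single    = no λ ()
fixed? r double    = no λ ()

run? : ∀ r x → Dec (Run r x)
run? r (fixed g) = no λ ()
run? r single    = r ≟ℕ 0
run? r double    = r <? 2

fits? : ∀ p r x → Dec (Fits p r x)
fits? none = fixed?
fits? up   = run?
fits? down = run?

SlotFits : Layout → Entry → Set
SlotFits L (_ , s , r , p) = AtSegment (Fits p r) L s

Admissible : ℕ → Parameter → ℕ → Set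
Admissible t none q = q ≡ 0
Admissible t up   q = q < t
Admissible t down q = q < t

fits⇒inSegment : ∀ t p r {q} x → Admissible t p q → Fits p r x → InSegment t x r q
fits⇒inSegment t none r (fixed g) q≡0 r<g = r<g , q≡0
fits⇒inSegment t up   r single    q<t r≡0 = r≡0 , q<t
fits⇒inSegment t up   r double    q<t r<2 = r<2 , q<t
fits⇒inSegment t down r single    q<t r≡0 = r≡0 , q<t
fits⇒inSegment t down r double    q<t r<2 = r<2 , q<t

isNone? : ∀ p → Dec (p ≡ none)
isNone? none = yes refl
isNone? up   = no λ ()
isNone? down = no λ ()

-- Families and their certificates

record Family : Set where
  field
    width           : ℕ
    layout          : Layout
    template        : Vec (Vec Entry (width + 4)) 3
    blockRowSums    : Vec ℤ 3
    rowMultiples    : Vec ℤ 3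
    columnMultiples : Vec ℤ width

module _ (F : Family) where
  open Family F

  entry : Fin 3 → Fin (width + 4) → Entry
  entry i x = lookup (lookup template i) x

  form : Fin 3 → Fin (width + 4) → Affine
  form i x = entryA layout (entry i x)

  modulusA : Affine
  modulusA = constant (+ (2 * (3 * width) + 1)) ⊕ + 24 · varT

  record Certificate : Set where
    field
      fixed-columns      : ∀ i (m : Fin width) → parameterOf (entry i (m ↑ˡ 4)) ≡ none
      block-columns      : ∀ i (c : Fin 4) → ¬ parameterOf (entry i (width ↑ʳ c)) ≡ none
      slots-fit          : ∀ i x → SlotFits layout (entry i x)
      slots-distinct     : ∀ i x i′ x′ → slotOf (entry i x) ≡ slotOf (entry i′ x′) →
                                        i ≡ i′ × x ≡ x′
      span-form          : spanA layout ≡ constant (+ (3 * width)) ⊕ + 12 · varT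
      row-forms          : ∀ i → ΣA width (form i ∘ (_↑ˡ 4)) ⊕ lookup blockRowSums i · varT
                                   ≡ lookup rowMultiples i · modulusA
      column-forms       : ∀ m → ΣA 3 (λ i → form i (m ↑ˡ 4)) ≡ lookup columnMultiples m · modulusA
      block-row-forms    : ∀ i → eliminateT (ΣA 4 (form i ∘ (width ↑ʳ_))) ≡ constant (lookup blockRowSums i)
      block-column-forms : ∀ c → eliminateT (ΣA 3 (λ i → form i (width ↑ʳ c))) ≡ constant (+ 0)

  certificate? : Dec Certificate
  certificate? = map′
    (λ (f , b , s , d , l , r , c , br , bc) → record
      { fixed-columns = f ; block-columns = b ; slots-fit = s ; slots-distinct = d ; span-form = l
      ; row-forms = r ; column-forms = c ; block-row-forms = br ; block-column-forms = bc })
    (λ C → let open Certificate C in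
      fixed-columns , block-columns , slots-fit , slots-distinct , span-form ,
      row-forms , column-forms , block-row-forms , block-column-forms)
    (      all? (λ i → all? λ m → isNone? (parameterOf (entry i (m ↑ˡ 4))))
    ×-dec all? (λ i → all? λ c → ¬? (isNone? (parameterOf (entry i (width ↑ʳ c)))))
    ×-dec all? (λ i → all? λ x → let (_ , s , r , p) = entry i x in at? (fits? p r) layout s)
    ×-dec all? (λ i → all? λ x → all? λ i′ → all? λ x′ →
            ≡-dec _≟ℕ_ _≟ℕ_ (slotOf (entry i x)) (slotOf (entry i′ x′))
              →-dec (i ≟ᶠ i′ ×-dec x ≟ᶠ x′))
    ×-dec spanA layout ≟ᴬ _
    ×-dec all? (λ i → _ ≟ᴬ _)
    ×-dec all? (λ m → _ ≟ᴬ _)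
    ×-dec all? (λ i → _ ≟ᴬ _)
    ×-dec all? (λ c → _ ≟ᴬ _))

  Integral : Set
  Integral = (∀ i → lookup rowMultiples i ≡ + 0) × (∀ m → lookup columnMultiples m ≡ + 0)

  integral? : Dec Integral
  integral? = all? (λ i → lookup rowMultiples i ≟ℤ + 0)
        ×-dec all? (λ m → lookup columnMultiples m ≟ℤ + 0)

-- The array of a certified family

opposite-complement : ∀ {t} (a : Fin t) → toℕ a + 1 + toℕ (opposite a) ≡ t
opposite-complement {t} a = begin
  toℕ a + 1 + toℕ (opposite a)       ≡⟨ cong₂ _+_ (+-comm (toℕ a) 1) (opposite-prop a) ⟩
  suc (toℕ a) + (t ∸ suc (toℕ a))    ≡⟨ m+[n∸m]≡n (toℕ<n a) ⟩
  t                                  ∎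
  where open ≡-Reasoning

module Construction (F : Family) (C : Certificate F) (t : ℕ) where
  open Family F
  open Certificate C

  n M : ℕ
  n = width + t * 4
  M = 2 * (3 * n) + 1

  fixedData : Fin width → Fin (width + 4) × ℕ × ℕ
  fixedData m = m ↑ˡ 4 , 0 , 0

  blockData : Fin t × Fin 4 → Fin (width + 4) × ℕ × ℕ
  blockData (a , c) = width ↑ʳ c , toℕ a , toℕ (opposite a)

  columnData : Fin n → Fin (width + 4) × ℕ × ℕ
  columnData j = [ fixedData , blockData ∘ remQuot {t} 4 ]′ (splitAt width j)

  cellValue : Fin 3 → Fin (width + 4) × ℕ × ℕ → ℤ
  cellValue i (x , a , k) = value t layout (entry F i x) a k

  array : Array 3 n
  array i j = cellValue i (columnData j)

  data Column : Fin n → Set where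
    fixedColumn : (m : Fin width) → Column (m ↑ˡ t * 4)
    blockColumn : (a : Fin t) (c : Fin 4) → Column (width ↑ʳ combine a c)

  column : ∀ j → Column j
  column j with splitAt width j in eq
  ... | inj₁ m = subst Column (splitAt⁻¹-↑ˡ eq) (fixedColumn m)
  ... | inj₂ l = subst Column (trans (cong (width ↑ʳ_) (combine-remQuot {t} 4 l)) (splitAt⁻¹-↑ʳ eq))
                   (blockColumn (proj₁ (remQuot {t} 4 l)) (proj₂ (remQuot {t} 4 l)))

  columnData-fixed : ∀ m → columnData (m ↑ˡ t * 4) ≡ fixedData m
  columnData-fixed m = cong [ fixedData , blockData ∘ remQuot {t} 4 ]′ (splitAt-↑ˡ width m (t * 4))

  columnData-block : ∀ a c → columnData (width ↑ʳ combine a c) ≡ blockData (a , c)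
  columnData-block a c =
    trans (cong [ fixedData , blockData ∘ remQuot {t} 4 ]′ (splitAt-↑ʳ width (t * 4) (combine a c)))
          (cong blockData (remQuot-combine a c))

  ⟪_⟫ : Affine → ℤ
  ⟪ f ⟫ = ⟦ f ⟧ (+ t) (+ 0) (+ 0)

  ⟪_⟫[_] : Affine → Fin t → ℤ
  ⟪ f ⟫[ a ] = ⟦ f ⟧ (+ t) (+ toℕ a) (+ toℕ (opposite a))

  fixedCell : Fin 3 × Fin width → ℤ
  fixedCell (i , m) = array i (m ↑ˡ t * 4)

  fixedForm : Fin 3 × Fin width → Affine
  fixedForm (i , m) = form F i (m ↑ˡ 4)

  blockCell : Fin t → Fin 3 × Fin 4 → ℤ
  blockCell a (i , c) = array i (width ↑ʳ combine a c)

  blockForm : Fin 3 × Fin 4 → Affine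
  blockForm (i , c) = form F i (width ↑ʳ c)

  fixedCell-form : ∀ im → fixedCell im ≡ ⟪ fixedForm im ⟫
  fixedCell-form (i , m) = trans (cong (cellValue i) (columnData-fixed m))
                                 (sym (⟦entryA⟧ t layout (entry F i (m ↑ˡ 4)) 0 0))

  blockCell-form : ∀ a ic → blockCell a ic ≡ ⟪ blockForm ic ⟫[ a ]
  blockCell-form a (i , c) = trans (cong (cellValue i) (columnData-block a c))
                                   (sym (⟦entryA⟧ t layout (entry F i (width ↑ʳ c)) (toℕ a) (toℕ (opposite a))))

  ⟪⟫-eliminateT : ∀ f a → ⟪ f ⟫[ a ] ≡ ⟪ eliminateT f ⟫[ a ]
  ⟪⟫-eliminateT f a = begin
    ⟦ f ⟧ (+ t) A K                  ≡⟨ cong (λ T → ⟦ f ⟧ T A K) t≡a+1+k ⟩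
    ⟦ f ⟧ (A ℤ.+ + 1 ℤ.+ K) A K      ≡⟨ ⟦eliminateT⟧ f (+ t) A K ⟨
    ⟦ eliminateT f ⟧ (+ t) A K       ∎
    where
    open ≡-Reasoning
    A = + toℕ a
    K = + toℕ (opposite a)
    t≡a+1+k : + t ≡ A ℤ.+ + 1 ℤ.+ K
    t≡a+1+k = trans (cong +_ (sym (opposite-complement a)))
                    (trans (pos-+ (toℕ a + 1) (toℕ (opposite a))) (cong (ℤ._+ K) (pos-+ (toℕ a) 1)))

  ⟪multiple⟫ : ∀ l a k → ⟦ l · modulusA F ⟧ (+ t) a k ≡ l ℤ.* + M
  ⟪multiple⟫ l a k = trans (⟦·⟧ l (modulusA F) (+ t) a k)
    (cong (ℤ._*_ l) (trans (⟦affineT⟧ (2 * (3 * width) + 1) 24 t a k) (cong +_ (expand width t))))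
    where
    expand : ∀ w t → 2 * (3 * w) + 1 + 24 * t ≡ 2 * (3 * (w + t * 4)) + 1
    expand = ℕ-Ring.solve-∀

  fixed-sum : ∀ k (cells : Fin k → Fin 3 × Fin width) →
    Σℤ k (fixedCell ∘ cells) ≡ ⟪ ΣA k (fixedForm ∘ cells) ⟫
  fixed-sum k cells =
    trans (Σℤ-cong k (fixedCell-form ∘ cells)) (sym (⟦ΣA⟧ k (fixedForm ∘ cells) (+ t) (+ 0) (+ 0)))

  block-sum : ∀ k (cells : Fin k → Fin 3 × Fin 4) a →
    Σℤ k (blockCell a ∘ cells) ≡ ⟪ eliminateT (ΣA k (blockForm ∘ cells)) ⟫[ a ]
  block-sum k cells a = trans (Σℤ-cong k (blockCell-form a ∘ cells))
    (trans (sym (⟦ΣA⟧ k (blockForm ∘ cells) (+ t) (+ toℕ a) (+ toℕ (opposite a))))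
           (⟪⟫-eliminateT (ΣA k (blockForm ∘ cells)) a))

  block-row-sum : ∀ i a → Σℤ 4 (blockCell a ∘ (i ,_)) ≡ lookup blockRowSums i
  block-row-sum i a = begin
    Σℤ 4 (blockCell a ∘ (i ,_))
      ≡⟨ block-sum 4 (i ,_) a ⟩
    ⟪ eliminateT (ΣA 4 (blockForm ∘ (i ,_))) ⟫[ a ]
      ≡⟨ cong ⟪_⟫[ a ] (block-row-forms i) ⟩
    ⟪ constant (lookup blockRowSums i) ⟫[ a ]
      ≡⟨ ⟦constant⟧ (lookup blockRowSums i) (+ t) (+ toℕ a) (+ toℕ (opposite a)) ⟩
    lookup blockRowSums i
      ∎
    where open ≡-Reasoning

  row-sum : ∀ i → rowSum array i ≡ lookup rowMultiples i ℤ.* + M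
  row-sum i = begin
    Σℤ n (array i)
      ≡⟨ Σℤ-↑ width (t * 4) (array i) ⟩
    Σℤ width (fixedCell ∘ (i ,_)) ℤ.+ Σℤ (t * 4) (array i ∘ (width ↑ʳ_))
      ≡⟨ cong₂ ℤ._+_ (fixed-sum width (i ,_)) (Σℤ-combine t 4 (array i ∘ (width ↑ʳ_))) ⟩
    ⟪ fixedPart ⟫ ℤ.+ Σℤ t (λ a → Σℤ 4 (blockCell a ∘ (i ,_)))
      ≡⟨ cong (ℤ._+_ ⟪ fixedPart ⟫) (trans (Σℤ-cong t (block-row-sum i)) (Σℤ-const t ρ)) ⟩
    ⟪ fixedPart ⟫ ℤ.+ ρ ℤ.* + t
      ≡⟨ cong (ℤ._+_ ⟪ fixedPart ⟫) ρ·varT≡ρt ⟨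
    ⟪ fixedPart ⟫ ℤ.+ ⟪ ρ · varT ⟫
      ≡⟨ ⟦⊕⟧ fixedPart (ρ · varT) (+ t) (+ 0) (+ 0) ⟨
    ⟪ fixedPart ⊕ ρ · varT ⟫
      ≡⟨ cong ⟪_⟫ (row-forms i) ⟩
    ⟪ lookup rowMultiples i · modulusA F ⟫
      ≡⟨ ⟪multiple⟫ (lookup rowMultiples i) (+ 0) (+ 0) ⟩
    lookup rowMultiples i ℤ.* + M
      ∎
    where
    open ≡-Reasoning
    ρ = lookup blockRowSums i
    fixedPart = ΣA width (fixedForm ∘ (i ,_))
    ρ·varT≡ρt : ⟪ ρ · varT ⟫ ≡ ρ ℤ.* + t
    ρ·varT≡ρt = trans (⟦·⟧ ρ varT (+ t) (+ 0) (+ 0)) (cong (ℤ._*_ ρ) (⟦varT⟧ (+ t) (+ 0) (+ 0)))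

  column-sum-fixed : ∀ m → colSum array (m ↑ˡ t * 4) ≡ lookup columnMultiples m ℤ.* + M
  column-sum-fixed m = begin
    Σℤ 3 (fixedCell ∘ (_, m))                     ≡⟨ fixed-sum 3 (_, m) ⟩
    ⟪ ΣA 3 (fixedForm ∘ (_, m)) ⟫                 ≡⟨ cong ⟪_⟫ (column-forms m) ⟩
    ⟪ lookup columnMultiples m · modulusA F ⟫      ≡⟨ ⟪multiple⟫ (lookup columnMultiples m) (+ 0) (+ 0) ⟩
    lookup columnMultiples m ℤ.* + M               ∎
    where open ≡-Reasoning

  column-sum-block : ∀ a c → colSum array (width ↑ʳ combine a c) ≡ + 0
  column-sum-block a c = begin
    Σℤ 3 (blockCell a ∘ (_, c))
      ≡⟨ block-sum 3 (_, c) a ⟩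
    ⟪ eliminateT (ΣA 3 (blockForm ∘ (_, c))) ⟫[ a ]
      ≡⟨ cong ⟪_⟫[ a ] (block-column-forms c) ⟩
    ⟪ constant (+ 0) ⟫[ a ]
      ≡⟨ ⟦constant⟧ (+ 0) (+ t) (+ toℕ a) (+ toℕ (opposite a)) ⟩
    + 0
      ∎
    where open ≡-Reasoning

  blockIndex : Parameter → ℕ → ℕ
  blockIndex none q = 0
  blockIndex up   q = q
  blockIndex down q = t ∸ suc q

  record Located (i : Fin 3) (j : Fin n) : Set where
    constructor located
    field
      templateColumn : Fin (width + 4)
      q              : ℕ
    e = entry F i templateColumn
    field
      valid     : ValidSlot t layout (segmentOf e) (offsetOf e) q
      magnitude : ∣ array i j ∣ ≡ suc (position t layout (segmentOf e) (offsetOf e) q)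
      index     : toℕ j ≡ toℕ templateColumn + 4 * blockIndex (parameterOf e) q

  admissible-fixed : ∀ p → p ≡ none → Admissible t p (parameterValue p 0 0)
  admissible-fixed none refl = refl

  index-fixed : ∀ (m : Fin width) p → p ≡ none →
    toℕ (m ↑ˡ t * 4) ≡ toℕ (m ↑ˡ 4) + 4 * blockIndex p (parameterValue p 0 0)
  index-fixed m none refl = trans (toℕ-↑ˡ m (t * 4)) (sym (trans (+-identityʳ _) (toℕ-↑ˡ m 4)))

  module _ (a : Fin t) where
    admissible-block : ∀ p → ¬ p ≡ none → Admissible t p (parameterValue p (toℕ a) (toℕ (opposite a)))
    admissible-block none p≢none = ⊥-elim (p≢none refl)
    admissible-block up   _      = toℕ<n a
    admissible-block down _      = toℕ<n (opposite a)

    blockIndex-block : ∀ p → ¬ p ≡ none →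
      blockIndex p (parameterValue p (toℕ a) (toℕ (opposite a))) ≡ toℕ a
    blockIndex-block none p≢none = ⊥-elim (p≢none refl)
    blockIndex-block up   _      = refl
    blockIndex-block down _      = trans (sym (opposite-prop (opposite a))) (cong toℕ (opposite-involutive a))

    index-block : ∀ (c : Fin 4) p → ¬ p ≡ none →
      toℕ (width ↑ʳ combine a c)
        ≡ toℕ (width ↑ʳ c) + 4 * blockIndex p (parameterValue p (toℕ a) (toℕ (opposite a)))
    index-block c p p≢none = begin
      toℕ (width ↑ʳ combine a c)     ≡⟨ toℕ-↑ʳ width (combine a c) ⟩
      width + toℕ (combine a c)      ≡⟨ cong (_+_ width) (toℕ-combine a c) ⟩
      width + (4 * toℕ a + toℕ c)    ≡⟨ regroup width (toℕ a) (toℕ c) ⟩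
      width + toℕ c + 4 * toℕ a
        ≡⟨ cong₂ (λ u v → u + 4 * v) (sym (toℕ-↑ʳ width c)) (sym (blockIndex-block p p≢none)) ⟩
      toℕ (width ↑ʳ c) + 4 * blockIndex p (parameterValue p (toℕ a) (toℕ (opposite a)))
                                     ∎
      where
      open ≡-Reasoning
      regroup : ∀ w a c → w + (4 * a + c) ≡ w + c + 4 * a
      regroup = ℕ-Ring.solve-∀

  locate : ∀ i j → Located i j
  locate i j with column j
  ... | fixedColumn m = located x (parameterValue p 0 0)
          (at-map (fits⇒inSegment t p (offsetOf e) _ (admissible-fixed p (fixed-columns i m)))
                  layout (segmentOf e) (slots-fit i x))
          (trans (cong (∣_∣ ∘ cellValue i) (columnData-fixed m)) (∣signed∣ (proj₁ e) _))
          (index-fixed m p (fixed-columns i m))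
    where
    x = m ↑ˡ 4
    e = entry F i x
    p = parameterOf e
  ... | blockColumn a c = located x (parameterValue p (toℕ a) (toℕ (opposite a)))
          (at-map (fits⇒inSegment t p (offsetOf e) _ (admissible-block a p (block-columns i c)))
                  layout (segmentOf e) (slots-fit i x))
          (trans (cong (∣_∣ ∘ cellValue i) (columnData-block a c)) (∣signed∣ (proj₁ e) _))
          (index-block a c p (block-columns i c))
    where
    x = width ↑ʳ c
    e = entry F i x
    p = parameterOf e

  distinct-magnitudes : ∀ i j i′ j′ → ∣ array i j ∣ ≡ ∣ array i′ j′ ∣ → i ≡ i′ × j ≡ j′
  distinct-magnitudes i j i′ j′ eq with locate i j | locate i′ j′
  ... | located x q v mag idx | located x′ q′ v′ mag′ idx′
    with position-injective t layout v v′ (suc-injective (trans (sym mag) (trans eq mag′)))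
  ... | s≡s′ , r≡r′ , refl with slots-distinct i x i′ x′ (cong₂ _,_ s≡s′ r≡r′)
  ... | refl , refl = refl , toℕ-injective (trans idx (sym idx′))

  span-is-3n : span t layout ≡ 3 * n
  span-is-3n = +-injective (begin
    + span t layout                              ≡⟨ ⟦spanA⟧ t (+ 0) (+ 0) layout ⟨
    ⟪ spanA layout ⟫                             ≡⟨ cong ⟪_⟫ span-form ⟩
    ⟪ constant (+ (3 * width)) ⊕ + 12 · varT ⟫   ≡⟨ ⟦affineT⟧ (3 * width) 12 t (+ 0) (+ 0) ⟩
    + (3 * width + 12 * t)                       ≡⟨ cong +_ (expand width t) ⟩
    + (3 * n)                                    ∎)
    where
    open ≡-Reasoning
    expand : ∀ w t → 3 * w + 12 * t ≡ 3 * (w + t * 4)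
    expand = ℕ-Ring.solve-∀

  entries : HeffterEntries 3 n array
  entries = bounded , distinct-magnitudes
    where
    bounded : ∀ i j → (- (+ (3 * n)) ℤ.≤ array i j) × (array i j ℤ.≤ + (3 * n)) × (array i j ≢ + 0)
    bounded i j = magnitude-bounds magnitude
      (subst (suc (position t layout (segmentOf e) (offsetOf e) q) ≤_) span-is-3n (position<span t layout valid))
      where open Located (locate i j)

  isHeffter : IsHeffter 3 n array
  isHeffter = entries , (λ i → ∣-multiple (lookup rowMultiples i) (+ M) (row-sum i)) , columns
    where
    columns : ∀ j → + M ∣ℤ colSum array j
    columns j with column j
    ... | fixedColumn m   = ∣-multiple (lookup columnMultiples m) (+ M) (column-sum-fixed m)
    ... | blockColumn a c = ∣-multiple (+ 0) (+ M) (column-sum-block a c)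

  isIntegerHeffter : Integral F → IsIntegerHeffter 3 n array
  isIntegerHeffter (rows≡0 , columns≡0) =
    entries , (λ i → trans (row-sum i) (cong (ℤ._* + M) (rows≡0 i))) , columns
    where
    columns : ∀ j → colSum array j ≡ + 0
    columns j with column j
    ... | fixedColumn m   = trans (column-sum-fixed m) (cong (ℤ._* + M) (columns≡0 m))
    ... | blockColumn a c = column-sum-block a c

HeffterArray IntegerHeffterArray : ℕ → Set
HeffterArray n        = Σ (Array 3 n) (IsHeffter 3 n)
IntegerHeffterArray n = Σ (Array 3 n) (IsIntegerHeffter 3 n)

heffter : (F : Family) → Certificate F → ∀ t → HeffterArray (Family.width F + t * 4)
heffter F C t = array , isHeffter
  where open Construction F C t

integerHeffter : (F : Family) → Certificate F → Integral F →
  ∀ t → IntegerHeffterArray (Family.width F + t * 4)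
integerHeffter F C I t = array , isIntegerHeffter I
  where open Construction F C t

-- The four families

family₃ : Family
family₃ = record
  { width           = 3
  ; layout          =
      double ∷ fixed 1 ∷ double ∷ fixed 2 ∷ single ∷ fixed 1 ∷ single ∷ single ∷
      single ∷ fixed 3 ∷ single ∷ single ∷ fixed 1 ∷ single ∷ fixed 1 ∷ single ∷ []
  ; template        =
      ( pos 1 0 none ∷ pos 9 0 none ∷ neg 9 1 none ∷
        pos 0 0 up ∷ neg 0 1 up ∷ pos 2 0 up ∷ neg 2 1 up ∷ [])
    ∷ ( pos 9 2 none ∷ neg 3 1 none ∷ neg 5 0 none ∷
        pos 6 0 down ∷ pos 13 0 up ∷ neg 8 0 up ∷ neg 10 0 down ∷ [])
    ∷ ( neg 12 0 none ∷ neg 3 0 none ∷ neg 14 0 none ∷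
        neg 7 0 up ∷ neg 11 0 down ∷ pos 4 0 down ∷ pos 15 0 up ∷ [])
    ∷ []
  ; blockRowSums    = (- (+ 2)) ∷ + 1 ∷ + 1 ∷ []
  ; rowMultiples    = + 0 ∷ + 0 ∷ (- (+ 1)) ∷ []
  ; columnMultiples = + 0 ∷ + 0 ∷ (- (+ 1)) ∷ []
  }

family₄ : Family
family₄ = record
  { width           = 4
  ; layout          =
      fixed 1 ∷ double ∷ fixed 1 ∷ double ∷ fixed 2 ∷ single ∷ single ∷ fixed 2 ∷
      single ∷ single ∷ fixed 1 ∷ single ∷ fixed 2 ∷ single ∷ fixed 1 ∷ single ∷
      single ∷ fixed 2 ∷ []
  ; template        =
      ( pos 0 0 none ∷ pos 2 0 none ∷ pos 4 0 none ∷ neg 7 1 none ∷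
        neg 1 0 up ∷ pos 1 1 up ∷ pos 3 0 up ∷ neg 3 1 up ∷ [])
    ∷ ( pos 12 0 none ∷ neg 17 1 none ∷ neg 10 0 none ∷ pos 17 0 none ∷
        neg 13 0 down ∷ pos 6 0 down ∷ neg 9 0 up ∷ pos 16 0 up ∷ [])
    ∷ ( neg 12 1 none ∷ pos 14 0 none ∷ pos 4 1 none ∷ neg 7 0 none ∷
        pos 15 0 up ∷ neg 8 0 up ∷ pos 5 0 down ∷ neg 11 0 down ∷ [])
    ∷ []
  ; blockRowSums    = + 0 ∷ (- (+ 1)) ∷ + 1 ∷ []
  ; rowMultiples    = + 0 ∷ + 0 ∷ + 0 ∷ []
  ; columnMultiples = + 0 ∷ + 0 ∷ + 0 ∷ + 0 ∷ []
  }

family₅ : Family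
family₅ = record
  { width           = 5
  ; layout          =
      fixed 3 ∷ double ∷ fixed 1 ∷ double ∷ fixed 2 ∷ single ∷ single ∷ fixed 4 ∷
      single ∷ single ∷ single ∷ fixed 2 ∷ single ∷ fixed 3 ∷ single ∷ single ∷ []
  ; template        =
      ( pos 0 0 none ∷ pos 0 1 none ∷ pos 7 0 none ∷ neg 2 0 none ∷ neg 4 1 none ∷
        pos 1 0 up ∷ neg 1 1 up ∷ neg 3 0 up ∷ pos 3 1 up ∷ [])
    ∷ ( pos 11 0 none ∷ neg 13 2 none ∷ pos 0 2 none ∷ pos 7 2 none ∷ neg 7 1 none ∷
        pos 12 0 down ∷ neg 6 0 down ∷ pos 9 0 up ∷ neg 15 0 up ∷ [])
    ∷ ( neg 11 1 none ∷ pos 13 0 none ∷ neg 7 3 none ∷ neg 4 0 none ∷ pos 13 1 none ∷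
        neg 14 0 up ∷ pos 8 0 up ∷ neg 5 0 down ∷ pos 10 0 down ∷ [])
    ∷ []
  ; blockRowSums    = + 0 ∷ + 1 ∷ (- (+ 1)) ∷ []
  ; rowMultiples    = + 0 ∷ + 0 ∷ + 0 ∷ []
  ; columnMultiples = + 0 ∷ + 0 ∷ + 0 ∷ + 0 ∷ + 0 ∷ []
  }

family₆ : Family
family₆ = record
  { width           = 6
  ; layout          =
      fixed 2 ∷ double ∷ fixed 3 ∷ double ∷ single ∷ fixed 3 ∷ single ∷ fixed 2 ∷
      single ∷ single ∷ fixed 2 ∷ single ∷ single ∷ fixed 3 ∷ single ∷ fixed 3 ∷
      single ∷ []
  ; template        =
      ( pos 0 0 none ∷ pos 0 1 none ∷ neg 13 1 none ∷ neg 7 1 none ∷ pos 10 1 none ∷ pos 7 0 none ∷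
        neg 1 0 up ∷ pos 1 1 up ∷ neg 3 0 up ∷ pos 3 1 up ∷ [])
    ∷ ( pos 2 1 none ∷ pos 13 0 none ∷ pos 2 0 none ∷ pos 15 0 none ∷ pos 15 2 none ∷ neg 15 1 none ∷
        neg 6 0 down ∷ neg 14 0 up ∷ pos 9 0 up ∷ pos 11 0 down ∷ [])
    ∷ ( neg 2 2 none ∷ neg 13 2 none ∷ pos 10 0 none ∷ neg 5 0 none ∷ pos 5 1 none ∷ pos 5 2 none ∷
        pos 8 0 up ∷ pos 12 0 down ∷ neg 4 0 down ∷ neg 16 0 up ∷ [])
    ∷ []
  ; blockRowSums    = + 2 ∷ (- (+ 1)) ∷ (- (+ 1)) ∷ []
  ; rowMultiples    = + 0 ∷ + 1 ∷ + 0 ∷ []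
  ; columnMultiples = + 0 ∷ + 0 ∷ + 0 ∷ + 0 ∷ + 1 ∷ + 0 ∷ []
  }


heffter-by-residue : ∀ r q → 3 ≤ r + q * 4 → r < 4 → HeffterArray (r + q * 4)
heffter-by-residue 0 (suc q) _ _ = heffter family₄ (from-yes (certificate? family₄)) q
heffter-by-residue 1 (suc q) _ _ = heffter family₅ (from-yes (certificate? family₅)) q
heffter-by-residue 2 (suc q) _ _ = heffter family₆ (from-yes (certificate? family₆)) q
heffter-by-residue 3 q       _ _ = heffter family₃ (from-yes (certificate? family₃)) q
heffter-by-residue 0 0 ()
heffter-by-residue 1 0 (s≤s ())
heffter-by-residue 2 0 (s≤s (s≤s ()))
heffter-by-residue (suc (suc (suc (suc _)))) _ _ (s≤s (s≤s (s≤s (s≤s ()))))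

integer-by-residue : ∀ r q → 3 ≤ r + q * 4 → r ≡ 0 ⊎ r ≡ 1 → IntegerHeffterArray (r + q * 4)
integer-by-residue 0 (suc q) _ _ =
  integerHeffter family₄ (from-yes (certificate? family₄)) (from-yes (integral? family₄)) q
integer-by-residue 1 (suc q) _ _ =
  integerHeffter family₅ (from-yes (certificate? family₅)) (from-yes (integral? family₅)) q
integer-by-residue 0 0 ()
integer-by-residue 1 0 (s≤s ())
integer-by-residue (suc (suc _)) _ _ (inj₁ ())
integer-by-residue (suc (suc _)) _ _ (inj₂ ())

theorem6 : (n : ℕ) → 3 ≤ n →
    Σ (Array 3 n) (λ A → IsHeffter 3 n A)
    × ((n % 4 ≡ 0 ⊎ n % 4 ≡ 1) → Σ (Array 3 n) (λ A → IsIntegerHeffter 3 n A))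
theorem6 n 3≤n =
  subst HeffterArray (sym n≡r+q*4) (heffter-by-residue r q 3≤r+q*4 (m%n<n n 4)) ,
  λ r∈01 → subst IntegerHeffterArray (sym n≡r+q*4) (integer-by-residue r q 3≤r+q*4 r∈01)
  where
  r = n % 4
  q = n / 4
  n≡r+q*4 : n ≡ r + q * 4
  n≡r+q*4 = m≡m%n+[m/n]*n n 4
  3≤r+q*4 : 3 ≤ r + q * 4
  3≤r+q*4 = subst (3 ≤_) n≡r+q*4 3≤n
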